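{- If a sequent $\vdash\Gamma$ is provable in $\mathsf{CacLL}_\Sigma$ (with the cut rule), then there is a proof of $\vdash\Gamma$ in which the cut rule is not applied.
   Context: $\mathsf{CacLL}_\Sigma$ is the one-sided classical non-associative non-commutative linear logic with subexponentials over a simply dependent multimodal signature $\Sigma=(I,\preceq,f)$, with $(I,\preceq)$ a preorder and $f:I\to 2^{\{\mathsf{C},\mathsf{W},\mathsf{A1},\mathsf{A2},\mathsf{E}\}}$ upward closed (if $i\preceq j$ then $f(i)\subseteq f(j)$). Sequents are $\vdash\Gamma$ with $\Gamma$ a non-empty binary-tree structure of formulae. Rules: $\otimes$ (from $\vdash(\Gamma,G)$ and $\vdash(\Delta,F)$ infer $\vdash((\Gamma,\Delta),F\otimes G)$), par $⅋$ (from $\vdash\Gamma\{(F,G)\}$ infer $\vdash\Gamma\{F⅋G\}$), $\oplus_i$, with $\mathbin{\&}$, $\bot$, $\mathsf{1}$, $\top$, top-level exchange and associativity, initial sequents $\vdash(A,A^\perp)$, cut (from $\vdash(\Gamma,A)$ and $\vdash(A^\perp,\Delta)$ infer $\vdash(\Gamma,\Delta)$), promotion (from $\vdash(\Gamma^{\uparrow i},F)$ infer $\vdash(\Gamma,!^iF)$), dereliction for $?^i$, and $?$-licensed structural rules (weakening, contraction, exchange, associativity) for labels whose $f$-value contains the corresponding axiom. -}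

module Defs where

open import Data.Nat using (ℕ)
open import Data.Bool using (Bool; true; false)
open import Relation.Binary.PropositionalEquality using (_≡_)
open import Relation.Binary.Structures using (IsPreorder)

data Axiom : Set where
  C W A1 A2 E : Axiom

record Signature : Set₁ where
  field
    I            : Set
    _≼_          : I → I → Set
    ≼-isPreorder : IsPreorder _≡_ _≼_
    -- f : I → 2^{C,W,A1,A2,E}, a subset given by its characteristic function
    f            : I → Axiom → Bool
    f-upward     : ∀ {i j} (a : Axiom) → i ≼ j → f i a ≡ true → f j a ≡ true

infixr 30 _⊗_ _⅋_
infixr 25 _⊕_ _&_

data Fm (L : Set) : Set where
  atom  : ℕ → Fm L
  natom : ℕ → Fm L
  _⊗_   : Fm L → Fm L → Fm L
  _⅋_   : Fm L → Fm L → Fm L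
  _⊕_   : Fm L → Fm L → Fm L
  _&_   : Fm L → Fm L → Fm L
  𝟏     : Fm L
  ⊥ᶠ    : Fm L
  ⊤ᶠ    : Fm L
  𝟎     : Fm L
  !⁽_⁾_ : L → Fm L → Fm L
  ?⁽_⁾_ : L → Fm L → Fm L

-- linear negation (non-commutative: the order is reversed for ⊗ / ⅋)
_ᗮ : ∀ {L} → Fm L → Fm L
atom p ᗮ    = natom p
natom p ᗮ   = atom p
(F ⊗ G) ᗮ   = (G ᗮ) ⅋ (F ᗮ)
(F ⅋ G) ᗮ   = (G ᗮ) ⊗ (F ᗮ)
(F ⊕ G) ᗮ   = (F ᗮ) & (G ᗮ)
(F & G) ᗮ   = (F ᗮ) ⊕ (G ᗮ)
𝟏 ᗮ         = ⊥ᶠ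
⊥ᶠ ᗮ        = 𝟏
⊤ᶠ ᗮ        = 𝟎
𝟎 ᗮ         = ⊤ᶠ
(!⁽ i ⁾ F) ᗮ = ?⁽ i ⁾ (F ᗮ)
(?⁽ i ⁾ F) ᗮ = !⁽ i ⁾ (F ᗮ)

data Str (L : Set) : Set where
  ⟨_⟩  : Fm L → Str L
  _,,_ : Str L → Str L → Str L

data Ctx (L : Set) : Set where
  □    : Ctx L
  _◂_  : Ctx L → Str L → Ctx L
  _▸_  : Str L → Ctx L → Ctx L

_[_] : ∀ {L} → Ctx L → Str L → Str L
□ [ Δ ]       = Δ
(Γ ◂ Θ) [ Δ ] = (Γ [ Δ ]) ,, Θ
(Θ ▸ Γ) [ Δ ] = Θ ,, (Γ [ Δ ])

module _ (Σ : Signature) where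
  open Signature Σ

  data Up (i : I) : Str I → Set where
    up  : ∀ {j G} → i ≼ j → Up i ⟨ ?⁽ j ⁾ G ⟩
    _,,_ : ∀ {Γ Δ} → Up i Γ → Up i Δ → Up i (Γ ,, Δ)

  data Lic (a : Axiom) : Str I → Set where
    lic  : ∀ {j G} → f j a ≡ true → Lic a ⟨ ?⁽ j ⁾ G ⟩
    _,,_ : ∀ {Γ Δ} → Lic a Γ → Lic a Δ → Lic a (Γ ,, Δ)

  data Mode : Set where
    withCut cutFree : Mode

  infix 4 ⊢[_]_

  data ⊢[_]_ : Mode → Str I → Set where
    init : ∀ {m} A → ⊢[ m ] (⟨ A ⟩ ,, ⟨ A ᗮ ⟩)
    cut  : ∀ {Γ Δ} A → ⊢[ withCut ] (Γ ,, ⟨ A ⟩) → ⊢[ withCut ] (⟨ A ᗮ ⟩ ,, Δ)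
         → ⊢[ withCut ] (Γ ,, Δ)
    ⊗R   : ∀ {m Γ Δ F G} → ⊢[ m ] (Γ ,, ⟨ G ⟩) → ⊢[ m ] (Δ ,, ⟨ F ⟩)
         → ⊢[ m ] ((Γ ,, Δ) ,, ⟨ F ⊗ G ⟩)
    ⅋R   : ∀ {m} (Γ : Ctx I) {F G} → ⊢[ m ] (Γ [ ⟨ F ⟩ ,, ⟨ G ⟩ ]) → ⊢[ m ] (Γ [ ⟨ F ⅋ G ⟩ ])
    𝟏R   : ∀ {m} → ⊢[ m ] ⟨ 𝟏 ⟩
    ⊥R   : ∀ {m Γ} → ⊢[ m ] Γ → ⊢[ m ] (Γ ,, ⟨ ⊥ᶠ ⟩)
    ⊕R₁  : ∀ {m Γ F G} → ⊢[ m ] (Γ ,, ⟨ F ⟩) → ⊢[ m ] (Γ ,, ⟨ F ⊕ G ⟩)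
    ⊕R₂  : ∀ {m Γ F G} → ⊢[ m ] (Γ ,, ⟨ G ⟩) → ⊢[ m ] (Γ ,, ⟨ F ⊕ G ⟩)
    &R   : ∀ {m Γ F G} → ⊢[ m ] (Γ ,, ⟨ F ⟩) → ⊢[ m ] (Γ ,, ⟨ G ⟩) → ⊢[ m ] (Γ ,, ⟨ F & G ⟩)
    ⊤R   : ∀ {m Γ} → ⊢[ m ] (Γ ,, ⟨ ⊤ᶠ ⟩)
    ex   : ∀ {m Γ Δ} → ⊢[ m ] (Γ ,, Δ) → ⊢[ m ] (Δ ,, Γ)
    asl  : ∀ {m Γ Δ Λ} → ⊢[ m ] (Γ ,, (Δ ,, Λ)) → ⊢[ m ] ((Γ ,, Δ) ,, Λ)
    asr  : ∀ {m Γ Δ Λ} → ⊢[ m ] ((Γ ,, Δ) ,, Λ) → ⊢[ m ] (Γ ,, (Δ ,, Λ))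
    prom : ∀ {m Γ i F} → Up i Γ → ⊢[ m ] (Γ ,, ⟨ F ⟩) → ⊢[ m ] (Γ ,, ⟨ !⁽ i ⁾ F ⟩)
    der  : ∀ {m Γ i F} → ⊢[ m ] (Γ ,, ⟨ F ⟩) → ⊢[ m ] (Γ ,, ⟨ ?⁽ i ⁾ F ⟩)
    wkr  : ∀ {m} (Γ : Ctx I) {Δ Θ} → Lic W Θ → ⊢[ m ] (Γ [ Δ ]) → ⊢[ m ] (Γ [ Δ ,, Θ ])
    wkl  : ∀ {m} (Γ : Ctx I) {Δ Θ} → Lic W Θ → ⊢[ m ] (Γ [ Δ ]) → ⊢[ m ] (Γ [ Θ ,, Δ ])
    ctr  : ∀ {m} (Γ : Ctx I) {Θ} → Lic C Θ → ⊢[ m ] (Γ [ Θ ,, Θ ]) → ⊢[ m ] (Γ [ Θ ])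
    exl  : ∀ {m} (Γ : Ctx I) {Θ Δ} → Lic E Θ → ⊢[ m ] (Γ [ Θ ,, Δ ]) → ⊢[ m ] (Γ [ Δ ,, Θ ])
    exr  : ∀ {m} (Γ : Ctx I) {Θ Δ} → Lic E Θ → ⊢[ m ] (Γ [ Δ ,, Θ ]) → ⊢[ m ] (Γ [ Θ ,, Δ ])
    a1l  : ∀ {m} (Γ : Ctx I) {Δ₁ Δ₂ Θ} → Lic A1 Θ
         → ⊢[ m ] (Γ [ Δ₁ ,, (Δ₂ ,, Θ) ]) → ⊢[ m ] (Γ [ (Δ₁ ,, Δ₂) ,, Θ ])
    a1r  : ∀ {m} (Γ : Ctx I) {Δ₁ Δ₂ Θ} → Lic A1 Θ
         → ⊢[ m ] (Γ [ (Δ₁ ,, Δ₂) ,, Θ ]) → ⊢[ m ] (Γ [ Δ₁ ,, (Δ₂ ,, Θ) ])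
    a2l  : ∀ {m} (Γ : Ctx I) {Θ Δ₁ Δ₂} → Lic A2 Θ
         → ⊢[ m ] (Γ [ Θ ,, (Δ₁ ,, Δ₂) ]) → ⊢[ m ] (Γ [ (Θ ,, Δ₁) ,, Δ₂ ])
    a2r  : ∀ {m} (Γ : Ctx I) {Θ Δ₁ Δ₂} → Lic A2 Θ
         → ⊢[ m ] (Γ [ (Θ ,, Δ₁) ,, Δ₂ ]) → ⊢[ m ] (Γ [ Θ ,, (Δ₁ ,, Δ₂) ])

-- Cut elimination by substitution.  To cut A against A ᗮ, every occurrence of
-- A in the cut-free proof of ⊢ Γ , A that descends from the cut formula is
-- replaced by the context Δ of the other premise.  Structural rules only move
-- these occurrences around, so they survive the replacement, with the one
-- proviso that for A = ?ⁱ F the structure replacing it must consist of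
-- formulae ?ʲ G with i ≼ j, which is exactly what promotion of the dual !ⁱ F ᗮ
-- provides (and by upward closure of f, such structures carry every structural
-- licence of ?ⁱ F).  Where an occurrence of A is introduced by a logical rule
-- one replaces, symmetrically, A ᗮ in the other premise by the premises of that
-- rule; where A ᗮ is introduced in turn, the cut is reduced to cuts on
-- immediate subformulae of A, so the whole argument is an induction on A.
module Submission where

open import Defs
open import Data.Empty using (⊥-elim)
open import Data.Unit using (⊤; tt)
open import Data.Bool using (true)
open import Data.Sum using (_⊎_; inj₁; inj₂; [_,_]) renaming (map to ⊎-map)
open import Function using (_∘_)
open import Relation.Binary.PropositionalEquality
  using (_≡_; _≢_; refl; sym; subst)
open import Relation.Binary.Structures using (IsPreorder)

ᗮ-involutive : ∀ {L} (A : Fm L) → A ᗮ ᗮ ≡ A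
ᗮ-involutive (atom p)   = refl
ᗮ-involutive (natom p)  = refl
ᗮ-involutive (A ⊗ B)    rewrite ᗮ-involutive A | ᗮ-involutive B = refl
ᗮ-involutive (A ⅋ B)    rewrite ᗮ-involutive A | ᗮ-involutive B = refl
ᗮ-involutive (A ⊕ B)    rewrite ᗮ-involutive A | ᗮ-involutive B = refl
ᗮ-involutive (A & B)    rewrite ᗮ-involutive A | ᗮ-involutive B = refl
ᗮ-involutive 𝟏          = refl
ᗮ-involutive ⊥ᶠ         = refl
ᗮ-involutive ⊤ᶠ         = refl
ᗮ-involutive 𝟎          = refl
ᗮ-involutive (!⁽ i ⁾ A) rewrite ᗮ-involutive A = refl
ᗮ-involutive (?⁽ i ⁾ A) rewrite ᗮ-involutive A = refl

ᗮ-irreflexive : ∀ {L} (A : Fm L) → A ᗮ ≢ A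
ᗮ-irreflexive (atom p)   ()
ᗮ-irreflexive (natom p)  ()
ᗮ-irreflexive (A ⊗ B)    ()
ᗮ-irreflexive (A ⅋ B)    ()
ᗮ-irreflexive (A ⊕ B)    ()
ᗮ-irreflexive (A & B)    ()
ᗮ-irreflexive 𝟏          ()
ᗮ-irreflexive ⊥ᶠ         ()
ᗮ-irreflexive ⊤ᶠ         ()
ᗮ-irreflexive 𝟎          ()
ᗮ-irreflexive (!⁽ i ⁾ A) ()
ᗮ-irreflexive (?⁽ i ⁾ A) ()

module CutElimination (Σ : Signature) where
  open Signature Σ
  open IsPreorder ≼-isPreorder using () renaming (trans to ≼-trans)

  variable
    i k : I
    a : Axiom
    A B F G : Fm I
    Γ Γ′ Δ Δ′ Θ Θ′ Π Π′ Π₁ Π₂ X Y Y₁ Y₂ : Str I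

  ⊢_ : Str I → Set
  ⊢ Π = ⊢[_]_ Σ cutFree Π

  Up-≼ : k ≼ i → Up Σ i Γ → Up Σ k Γ
  Up-≼ k≼i (up i≼j) = up (≼-trans k≼i i≼j)
  Up-≼ k≼i (u ,, v) = Up-≼ k≼i u ,, Up-≼ k≼i v

  Up⇒Lic : f i a ≡ true → Up Σ i Γ → Lic Σ a Γ
  Up⇒Lic {a = a} fᵢa (up i≼j) = lic (f-upward a i≼j fᵢa)
  Up⇒Lic fᵢa (u ,, v) = Up⇒Lic fᵢa u ,, Up⇒Lic fᵢa v

  RightRule : Str I → Str I → Set
  RightRule Δ Y = ∀ {R} → ⊢ (R ,, Δ) → ⊢ (R ,, Y)

  -- Rotating the tree of Γ [ Y ] ,, Θ by top-level exchange and associativity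
  -- brings Y to the top level; remainder Γ Θ is what is left beside it.
  remainder : Ctx I → Str I → Str I
  remainder □       Θ = Θ
  remainder (Γ ◂ Λ) Θ = remainder Γ (Λ ,, Θ)
  remainder (Λ ▸ Γ) Θ = remainder Γ (Θ ,, Λ)

  rotate-out : ∀ Γ Θ → ⊢ ((Γ [ Y ]) ,, Θ) → ⊢ (remainder Γ Θ ,, Y)
  rotate-out □       Θ = ex
  rotate-out (Γ ◂ Λ) Θ = rotate-out Γ (Λ ,, Θ) ∘ asr
  rotate-out (Λ ▸ Γ) Θ = rotate-out Γ (Θ ,, Λ) ∘ ex ∘ asl ∘ ex

  rotate-in : ∀ Γ Θ → ⊢ (remainder Γ Θ ,, Y) → ⊢ ((Γ [ Y ]) ,, Θ)
  rotate-in □       Θ = ex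
  rotate-in (Γ ◂ Λ) Θ = asl ∘ rotate-in Γ (Λ ,, Θ)
  rotate-in (Λ ▸ Γ) Θ = ex ∘ asr ∘ ex ∘ rotate-in Γ (Θ ,, Λ)

  RightRule-,, : RightRule Δ Y₁ → RightRule Δ′ Y₂ → RightRule (Δ ,, Δ′) (Y₁ ,, Y₂)
  RightRule-,, r₁ r₂ = asr ∘ ex ∘ asr ∘ r₁ ∘ asl ∘ ex ∘ r₂ ∘ asl

  RightRule-[] : ∀ Γ Θ → RightRule Δ Y → ⊢ ((Γ [ Δ ]) ,, Θ) → ⊢ ((Γ [ Y ]) ,, Θ)
  RightRule-[] Γ Θ r = rotate-in Γ Θ ∘ r ∘ rotate-out Γ Θ

  replace-pair : RightRule Δ Y₁ → RightRule Δ′ Y₂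
               → ∀ Γ → ⊢ (Γ [ Δ ,, Δ′ ]) → ⊢ (Γ [ Y₁ ,, Y₂ ])
  replace-pair r₁ r₂ □       = ex ∘ r₁ ∘ ex ∘ r₂
  replace-pair r₁ r₂ (Γ ◂ Θ) = RightRule-[] Γ Θ (RightRule-,, r₁ r₂)
  replace-pair r₁ r₂ (Θ ▸ Γ) = ex ∘ RightRule-[] Γ Θ (RightRule-,, r₁ r₂) ∘ ex

  -- Every introduction rule for B remains admissible when its conclusion B is
  -- replaced by X.
  IntroAdmissible : Fm I → Str I → Set
  IntroAdmissible (F ⊗ G)    X = ∀ {Γ Δ} → ⊢ (Γ ,, ⟨ G ⟩) → ⊢ (Δ ,, ⟨ F ⟩) → ⊢ ((Γ ,, Δ) ,, X)
  IntroAdmissible (F ⅋ G)    X = ∀ Γ → ⊢ (Γ [ ⟨ F ⟩ ,, ⟨ G ⟩ ]) → ⊢ (Γ [ X ])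
  IntroAdmissible (F ⊕ G)    X = ∀ {Γ} → ⊢ (Γ ,, ⟨ F ⟩) ⊎ ⊢ (Γ ,, ⟨ G ⟩) → ⊢ (Γ ,, X)
  IntroAdmissible (F & G)    X = ∀ {Γ} → ⊢ (Γ ,, ⟨ F ⟩) → ⊢ (Γ ,, ⟨ G ⟩) → ⊢ (Γ ,, X)
  IntroAdmissible 𝟏          X = ⊢ X
  IntroAdmissible ⊥ᶠ         X = ∀ {Γ} → ⊢ Γ → ⊢ (Γ ,, X)
  IntroAdmissible ⊤ᶠ         X = ∀ {Γ} → ⊢ (Γ ,, X)
  IntroAdmissible (!⁽ i ⁾ F) X = ∀ {Γ} → Up Σ i Γ → ⊢ (Γ ,, ⟨ F ⟩) → ⊢ (Γ ,, X)
  IntroAdmissible (?⁽ i ⁾ F) X = ∀ {Γ} → ⊢ (Γ ,, ⟨ F ⟩) → ⊢ (Γ ,, X)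
  IntroAdmissible (atom p)   X = ⊤
  IntroAdmissible (natom p)  X = ⊤
  IntroAdmissible 𝟎          X = ⊤

  UpLike : Fm I → Str I → Set
  UpLike (?⁽ i ⁾ F) X = Up Σ i X
  UpLike _          X = ⊤

  record Replaceable (B : Fm I) (X : Str I) : Set where
    field
      axiom  : ⊢ (X ,, ⟨ B ᗮ ⟩)
      upLike : UpLike B X
      intro  : IntroAdmissible B X

  open Replaceable

  data Replacing (B : Fm I) (X : Str I) : Str I → Str I → Set where
    keep : Replacing B X ⟨ F ⟩ ⟨ F ⟩
    here : F ≡ B → Replacing B X ⟨ F ⟩ X
    _,,_ : Replacing B X Γ Γ′ → Replacing B X Δ Δ′ → Replacing B X (Γ ,, Δ) (Γ′ ,, Δ′)

  data ReplacingCtx (B : Fm I) (X : Str I) : Ctx I → Ctx I → Set where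
    □   : ReplacingCtx B X □ □
    _◂_ : ∀ {Γ Γ′} → ReplacingCtx B X Γ Γ′ → Replacing B X Θ Θ′
        → ReplacingCtx B X (Γ ◂ Θ) (Γ′ ◂ Θ′)
    _▸_ : ∀ {Γ Γ′} → Replacing B X Θ Θ′ → ReplacingCtx B X Γ Γ′
        → ReplacingCtx B X (Θ ▸ Γ) (Θ′ ▸ Γ′)

  Replacing-refl : ∀ Γ → Replacing B X Γ Γ
  Replacing-refl ⟨ F ⟩    = keep
  Replacing-refl (Γ ,, Δ) = Replacing-refl Γ ,, Replacing-refl Δ

  Replacing-[] : ∀ {Γ Γ′} → ReplacingCtx B X Γ Γ′ → Replacing B X Δ Δ′
               → Replacing B X (Γ [ Δ ]) (Γ′ [ Δ′ ])
  Replacing-[] □       s = s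
  Replacing-[] (c ◂ t) s = Replacing-[] c s ,, t
  Replacing-[] (t ▸ c) s = t ,, Replacing-[] c s

  data Plugged (B : Fm I) (X : Str I) (Γ : Ctx I) (Δ : Str I) : Str I → Set where
    plugged : ∀ {Γ′} → ReplacingCtx B X Γ Γ′ → Replacing B X Δ Δ′ → Plugged B X Γ Δ (Γ′ [ Δ′ ])

  Replacing-[]⁻¹ : ∀ Γ → Replacing B X (Γ [ Δ ]) Y → Plugged B X Γ Δ Y
  Replacing-[]⁻¹ □ s = plugged □ s
  Replacing-[]⁻¹ (Γ ◂ Θ) (s ,, t) with Replacing-[]⁻¹ Γ s
  ... | plugged c s′ = plugged (c ◂ t) s′
  Replacing-[]⁻¹ (Θ ▸ Γ) (t ,, s) with Replacing-[]⁻¹ Γ s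
  ... | plugged c s′ = plugged (t ▸ c) s′

  Up-Replacing : UpLike B X → Up Σ k Θ → Replacing B X Θ Θ′ → Up Σ k Θ′
  Up-Replacing x u        keep        = u
  Up-Replacing x (up k≼j) (here refl) = Up-≼ k≼j x
  Up-Replacing x (u ,, v) (s ,, t)    = Up-Replacing x u s ,, Up-Replacing x v t

  Lic-Replacing : UpLike B X → Lic Σ a Θ → Replacing B X Θ Θ′ → Lic Σ a Θ′
  Lic-Replacing x l         keep        = l
  Lic-Replacing x (lic fⱼa) (here refl) = Up⇒Lic fⱼa x
  Lic-Replacing x (l ,, m)  (s ,, t)    = Lic-Replacing x l s ,, Lic-Replacing x m t

  replace : Replaceable B X → ⊢ Π → Replacing B X Π Π′ → ⊢ Π′
  replace H (init A) (keep ,, keep)        = init A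
  replace H (init A) (here refl ,, keep)   = axiom H
  replace H (init A) (keep ,, here refl)   = ex (subst (λ C → ⊢ (_ ,, ⟨ C ⟩)) (ᗮ-involutive A) (axiom H))
  replace H (init A) (here refl ,, here e) = ⊥-elim (ᗮ-irreflexive A e)
  replace H (⊗R d e) ((s ,, t) ,, keep)      = ⊗R (replace H d (s ,, keep)) (replace H e (t ,, keep))
  replace H (⊗R d e) ((s ,, t) ,, here refl) = intro H (replace H d (s ,, keep)) (replace H e (t ,, keep))
  replace H (⅋R Γ d) s with Replacing-[]⁻¹ Γ s
  ... | plugged c keep        = ⅋R _ (replace H d (Replacing-[] c (keep ,, keep)))
  ... | plugged c (here refl) = intro H _ (replace H d (Replacing-[] c (keep ,, keep)))
  replace H 𝟏R keep        = 𝟏R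
  replace H 𝟏R (here refl) = intro H
  replace H (⊥R d) (s ,, keep)      = ⊥R (replace H d s)
  replace H (⊥R d) (s ,, here refl) = intro H (replace H d s)
  replace H (⊕R₁ d) (s ,, keep)      = ⊕R₁ (replace H d (s ,, keep))
  replace H (⊕R₁ d) (s ,, here refl) = intro H (inj₁ (replace H d (s ,, keep)))
  replace H (⊕R₂ d) (s ,, keep)      = ⊕R₂ (replace H d (s ,, keep))
  replace H (⊕R₂ d) (s ,, here refl) = intro H (inj₂ (replace H d (s ,, keep)))
  replace H (&R d e) (s ,, keep)      = &R (replace H d (s ,, keep)) (replace H e (s ,, keep))
  replace H (&R d e) (s ,, here refl) = intro H (replace H d (s ,, keep)) (replace H e (s ,, keep))
  replace H ⊤R (s ,, keep)      = ⊤R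
  replace H ⊤R (s ,, here refl) = intro H
  replace H (ex d)  (s ,, t)        = ex (replace H d (t ,, s))
  replace H (asl d) ((s ,, t) ,, u) = asl (replace H d (s ,, (t ,, u)))
  replace H (asr d) (s ,, (t ,, u)) = asr (replace H d ((s ,, t) ,, u))
  replace H (prom u d) (s ,, keep)      = prom (Up-Replacing (upLike H) u s) (replace H d (s ,, keep))
  replace H (prom u d) (s ,, here refl) = intro H (Up-Replacing (upLike H) u s) (replace H d (s ,, keep))
  replace H (der d) (s ,, keep)      = der (replace H d (s ,, keep))
  replace H (der d) (s ,, here refl) = intro H (replace H d (s ,, keep))
  replace H (wkr Γ l d) s with Replacing-[]⁻¹ Γ s
  ... | plugged c (t ,, u) = wkr _ (Lic-Replacing (upLike H) l u) (replace H d (Replacing-[] c t))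
  replace H (wkl Γ l d) s with Replacing-[]⁻¹ Γ s
  ... | plugged c (u ,, t) = wkl _ (Lic-Replacing (upLike H) l u) (replace H d (Replacing-[] c t))
  replace H (ctr Γ l d) s with Replacing-[]⁻¹ Γ s
  ... | plugged c t = ctr _ (Lic-Replacing (upLike H) l t) (replace H d (Replacing-[] c (t ,, t)))
  replace H (exl Γ l d) s with Replacing-[]⁻¹ Γ s
  ... | plugged c (t ,, u) = exl _ (Lic-Replacing (upLike H) l u) (replace H d (Replacing-[] c (u ,, t)))
  replace H (exr Γ l d) s with Replacing-[]⁻¹ Γ s
  ... | plugged c (u ,, t) = exr _ (Lic-Replacing (upLike H) l u) (replace H d (Replacing-[] c (t ,, u)))
  replace H (a1l Γ l d) s with Replacing-[]⁻¹ Γ s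
  ... | plugged c ((t ,, u) ,, v) =
    a1l _ (Lic-Replacing (upLike H) l v) (replace H d (Replacing-[] c (t ,, (u ,, v))))
  replace H (a1r Γ l d) s with Replacing-[]⁻¹ Γ s
  ... | plugged c (t ,, (u ,, v)) =
    a1r _ (Lic-Replacing (upLike H) l v) (replace H d (Replacing-[] c ((t ,, u) ,, v)))
  replace H (a2l Γ l d) s with Replacing-[]⁻¹ Γ s
  ... | plugged c ((v ,, t) ,, u) =
    a2l _ (Lic-Replacing (upLike H) l v) (replace H d (Replacing-[] c (v ,, (t ,, u))))
  replace H (a2r Γ l d) s with Replacing-[]⁻¹ Γ s
  ... | plugged c (v ,, (t ,, u)) =
    a2r _ (Lic-Replacing (upLike H) l v) (replace H d (Replacing-[] c ((v ,, t) ,, u)))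

  replace-right : Replaceable B X → ⊢ (Γ ,, ⟨ B ⟩) → ⊢ (Γ ,, X)
  replace-right H d = replace H d (Replacing-refl _ ,, here refl)

  replace-left : Replaceable B X → ⊢ (⟨ B ⟩ ,, Δ) → ⊢ (X ,, Δ)
  replace-left H = ex ∘ replace-right H ∘ ex

  CutAdmissible : Fm I → Set
  CutAdmissible A = ∀ {Γ Δ} → ⊢ (Γ ,, ⟨ A ⟩) → ⊢ (⟨ A ᗮ ⟩ ,, Δ) → ⊢ (Γ ,, Δ)

  ᗮᗮ-intro : ∀ A → ⊢ (Γ ,, ⟨ A ⟩) → ⊢ (Γ ,, ⟨ A ᗮ ᗮ ⟩)
  ᗮᗮ-intro A = subst (λ C → ⊢ (_ ,, ⟨ C ⟩)) (sym (ᗮ-involutive A))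

  CutAdmissible-ᗮ : ∀ A → CutAdmissible A → CutAdmissible (A ᗮ)
  CutAdmissible-ᗮ A cutA d e = ex (cutA (ex (subst (λ C → ⊢ (⟨ C ⟩ ,, _)) (ᗮ-involutive A) e)) (ex d))

  cut-rule : CutAdmissible A → ⊢ (Π ,, ⟨ A ᗮ ⟩) → RightRule ⟨ A ⟩ Π
  cut-rule cutA e d = cutA d (ex e)

  ⅋-replaceable : CutAdmissible A → CutAdmissible B
                → ⊢ (Π₁ ,, ⟨ A ᗮ ⟩) → ⊢ (Π₂ ,, ⟨ B ᗮ ⟩) → Replaceable (A ⅋ B) (Π₁ ,, Π₂)
  ⅋-replaceable cutA cutB e₁ e₂ = record
    { axiom  = ⊗R e₁ e₂
    ; upLike = tt
    ; intro  = replace-pair (cut-rule cutA e₁) (cut-rule cutB e₂)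
    }

  &-replaceable : CutAdmissible A → CutAdmissible B
                → ⊢ (Π ,, ⟨ A ᗮ ⟩) ⊎ ⊢ (Π ,, ⟨ B ᗮ ⟩) → Replaceable (A & B) Π
  &-replaceable cutA cutB e = record
    { axiom  = [ ⊕R₁ , ⊕R₂ ] e
    ; upLike = tt
    ; intro  = λ d₁ d₂ → [ (λ e₁ → cut-rule cutA e₁ d₁) , (λ e₂ → cut-rule cutB e₂ d₂) ] e
    }

  ?-replaceable : CutAdmissible A → Up Σ i Π → ⊢ (Π ,, ⟨ A ᗮ ⟩) → Replaceable (?⁽ i ⁾ A) Π
  ?-replaceable cutA u e = record { axiom = prom u e ; upLike = u ; intro = cut-rule cutA e }

  𝟏-replaceable : ⊢ Π → Replaceable 𝟏 Π
  𝟏-replaceable d = record { axiom = ⊥R d ; upLike = tt ; intro = d }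

  -- For ⊗, ⊕, !, ⊥ and atoms the cut formula is replaced in the left premise,
  -- for their duals the dual is replaced in the right premise.
  cut-admissible : ∀ A → CutAdmissible A
  cut-admissible (atom p)  d e = replace-right record { axiom = ex e ; upLike = tt ; intro = tt } d
  cut-admissible (natom p) d e = replace-right record { axiom = ex e ; upLike = tt ; intro = tt } d
  cut-admissible 𝟎         d e = replace-right record { axiom = ex e ; upLike = tt ; intro = tt } d
  cut-admissible ⊤ᶠ d e = replace-left record { axiom = d ; upLike = tt ; intro = tt } e
  cut-admissible ⊥ᶠ d e = replace-right record
    { axiom = ex e ; upLike = tt ; intro = λ d′ → replace-left (𝟏-replaceable d′) e } d
  cut-admissible 𝟏 d e = replace-left record
    { axiom = d ; upLike = tt ; intro = λ e′ → ex (replace-right (𝟏-replaceable e′) d) } e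
  cut-admissible (F ⊗ G) d e = replace-right record
    { axiom  = ex e
    ; upLike = tt
    ; intro  = λ e₁ e₂ → replace-left
        (⅋-replaceable (CutAdmissible-ᗮ G (cut-admissible G)) (CutAdmissible-ᗮ F (cut-admissible F))
                       (ᗮᗮ-intro G e₁) (ᗮᗮ-intro F e₂)) e
    } d
  cut-admissible (F ⅋ G) d e = replace-left record
    { axiom  = ᗮᗮ-intro (F ⅋ G) d
    ; upLike = tt
    ; intro  = λ e₁ e₂ → ex (replace-right (⅋-replaceable (cut-admissible F) (cut-admissible G) e₁ e₂) d)
    } e
  cut-admissible (F ⊕ G) d e = replace-right record
    { axiom  = ex e
    ; upLike = tt
    ; intro  = λ e′ → replace-left
        (&-replaceable (CutAdmissible-ᗮ F (cut-admissible F)) (CutAdmissible-ᗮ G (cut-admissible G))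
                       (⊎-map (ᗮᗮ-intro F) (ᗮᗮ-intro G) e′)) e
    } d
  cut-admissible (F & G) d e = replace-left record
    { axiom  = ᗮᗮ-intro (F & G) d
    ; upLike = tt
    ; intro  = λ e′ → ex (replace-right (&-replaceable (cut-admissible F) (cut-admissible G) e′) d)
    } e
  cut-admissible (!⁽ i ⁾ F) d e = replace-right record
    { axiom  = ex e
    ; upLike = tt
    ; intro  = λ u e′ → replace-left
        (?-replaceable (CutAdmissible-ᗮ F (cut-admissible F)) u (ᗮᗮ-intro F e′)) e
    } d
  cut-admissible (?⁽ i ⁾ F) d e = replace-left record
    { axiom  = ᗮᗮ-intro (?⁽ i ⁾ F) d
    ; upLike = tt
    ; intro  = λ u e′ → ex (replace-right (?-replaceable (cut-admissible F) u e′) d)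
    } e

  eliminate-cuts : ⊢[_]_ Σ withCut Π → ⊢ Π
  eliminate-cuts (init A)    = init A
  eliminate-cuts (cut A d e) = cut-admissible A (eliminate-cuts d) (eliminate-cuts e)
  eliminate-cuts (⊗R d e)    = ⊗R (eliminate-cuts d) (eliminate-cuts e)
  eliminate-cuts (⅋R Γ d)    = ⅋R Γ (eliminate-cuts d)
  eliminate-cuts 𝟏R          = 𝟏R
  eliminate-cuts (⊥R d)      = ⊥R (eliminate-cuts d)
  eliminate-cuts (⊕R₁ d)     = ⊕R₁ (eliminate-cuts d)
  eliminate-cuts (⊕R₂ d)     = ⊕R₂ (eliminate-cuts d)
  eliminate-cuts (&R d e)    = &R (eliminate-cuts d) (eliminate-cuts e)
  eliminate-cuts ⊤R          = ⊤R
  eliminate-cuts (ex d)      = ex (eliminate-cuts d)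
  eliminate-cuts (asl d)     = asl (eliminate-cuts d)
  eliminate-cuts (asr d)     = asr (eliminate-cuts d)
  eliminate-cuts (prom u d)  = prom u (eliminate-cuts d)
  eliminate-cuts (der d)     = der (eliminate-cuts d)
  eliminate-cuts (wkr Γ l d) = wkr Γ l (eliminate-cuts d)
  eliminate-cuts (wkl Γ l d) = wkl Γ l (eliminate-cuts d)
  eliminate-cuts (ctr Γ l d) = ctr Γ l (eliminate-cuts d)
  eliminate-cuts (exl Γ l d) = exl Γ l (eliminate-cuts d)
  eliminate-cuts (exr Γ l d) = exr Γ l (eliminate-cuts d)
  eliminate-cuts (a1l Γ l d) = a1l Γ l (eliminate-cuts d)
  eliminate-cuts (a1r Γ l d) = a1r Γ l (eliminate-cuts d)
  eliminate-cuts (a2l Γ l d) = a2l Γ l (eliminate-cuts d)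
  eliminate-cuts (a2r Γ l d) = a2r Γ l (eliminate-cuts d)

theorem2p1 : (Σ : Signature) (Γ : Str (Signature.I Σ))
    → ⊢[_]_ Σ withCut Γ → ⊢[_]_ Σ cutFree Γ
theorem2p1 Σ Γ = CutElimination.eliminate-cuts Σ
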